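{- Let $R$ be a simple graph on vertex set $V$ and $W\subseteq V$. Let $a,b\in\mathbb{N}$ with $2\le a\le b\le\binom{a}{\lfloor a/2\rfloor}$. If the induced subgraph $R[W]$ contains the complete bipartite graph $K_{a,b}$ as a spanning subgraph, then $R[W]$ has a non-trivial good orientation. If $R[W]$ is isomorphic to $K_{1,1}$, then $R[W]$ has a good orientation.
   Context: For $W\subseteq V$, an orientation $O_W$ of $R[W]$ is good if there is a partition of $W$ into two sets $U_1$ and $V_1$ (the partition classes) such that (i) $d_{O_W}(x,y)\le 2$ whenever $x,y$ are both in $U_1$ or both in $V_1$ (distance in the digraph $O_W$, i.e. length of a shortest directed path). It is a non-trivial good orientation if in addition (ii) every vertex of $U_1$ has an in-neighbor and an out-neighbor in $V_1$, and every vertex of $V_1$ has an in-neighbor and an out-neighbor in $U_1$. -}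

module Defs where

open import Data.Nat using (ℕ)
open import Data.Fin using (Fin)
open import Data.Fin.Subset using (Subset; _∈_; _∉_; ∣_∣)
open import Data.Product using (Σ; ∃; _×_; _,_)
open import Data.Sum using (_⊎_)
open import Data.Empty using (⊥)
open import Relation.Nullary using (¬_)
open import Relation.Binary.Definitions using (Decidable)
open import Relation.Binary.PropositionalEquality using (_≡_)

record SimpleGraph (n : ℕ) : Set₁ where
  field
    Adj   : Fin n → Fin n → Set
    adj?  : Decidable Adj
    sym   : ∀ {x y} → Adj x y → Adj y x
    irrefl : ∀ {x} → ¬ Adj x x
open SimpleGraph public

record Orientation {n : ℕ} (R : SimpleGraph n) (W : Subset n) : Set₁ where
  field
    Arc       : Fin n → Fin n → Set
    arc-edge  : ∀ {x y} → Arc x y → x ∈ W × y ∈ W × Adj R x y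
    edge-arc  : ∀ {x y} → x ∈ W → y ∈ W → Adj R x y → Arc x y ⊎ Arc y x
    antisym   : ∀ {x y} → Arc x y → ¬ Arc y x
open Orientation public

Dist≤2 : ∀ {n} {R : SimpleGraph n} {W : Subset n} →
         Orientation R W → Fin n → Fin n → Set
Dist≤2 O x y = x ≡ y ⊎ Arc O x y ⊎ ∃ λ z → Arc O x z × Arc O z y

IsPartition : ∀ {n} → Subset n → Subset n → Subset n → Set
IsPartition W U₁ V₁ =
  (∀ x → x ∈ W → x ∈ U₁ ⊎ x ∈ V₁) ×
  (∀ x → x ∈ U₁ → x ∈ W) ×
  (∀ x → x ∈ V₁ → x ∈ W) ×
  (∀ x → x ∈ U₁ → x ∉ V₁)

Cond-i : ∀ {n} {R : SimpleGraph n} {W : Subset n} →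
         Orientation R W → Subset n → Subset n → Set
Cond-i O U₁ V₁ =
  (∀ x y → x ∈ U₁ → y ∈ U₁ → Dist≤2 O x y) ×
  (∀ x y → x ∈ V₁ → y ∈ V₁ → Dist≤2 O x y)

Cond-ii : ∀ {n} {R : SimpleGraph n} {W : Subset n} →
          Orientation R W → Subset n → Subset n → Set
Cond-ii O U₁ V₁ =
  (∀ x → x ∈ U₁ → (∃ λ y → y ∈ V₁ × Arc O y x) × (∃ λ y → y ∈ V₁ × Arc O x y)) ×
  (∀ x → x ∈ V₁ → (∃ λ y → y ∈ U₁ × Arc O y x) × (∃ λ y → y ∈ U₁ × Arc O x y))

IsGood : ∀ {n} {R : SimpleGraph n} {W : Subset n} → Orientation R W → Set
IsGood {n} {W = W} O =
  Σ (Subset n) λ U₁ → Σ (Subset n) λ V₁ → IsPartition W U₁ V₁ × Cond-i O U₁ V₁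

IsNontrivialGood : ∀ {n} {R : SimpleGraph n} {W : Subset n} → Orientation R W → Set
IsNontrivialGood {n} {W = W} O =
  Σ (Subset n) λ U₁ → Σ (Subset n) λ V₁ →
    IsPartition W U₁ V₁ × Cond-i O U₁ V₁ × Cond-ii O U₁ V₁

HasSpanningKab : ∀ {n} → SimpleGraph n → Subset n → ℕ → ℕ → Set
HasSpanningKab {n} R W a b =
  Σ (Subset n) λ A → Σ (Subset n) λ B →
    IsPartition W A B × ∣ A ∣ ≡ a × ∣ B ∣ ≡ b ×
    (∀ x y → x ∈ A → y ∈ B → Adj R x y)

IsK11 : ∀ {n} → SimpleGraph n → Subset n → Set
IsK11 {n} R W =
  Σ (Fin n) λ x → Σ (Fin n) λ y →
    ¬ x ≡ y × x ∈ W × y ∈ W × (∀ z → z ∈ W → z ≡ x ⊎ z ≡ y) × Adj R x y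

module Submission where

-- Index the two sides of the spanning K_{a,b} as a_i (i < a) and b_j (j < b), and orient a_i → b_j
-- exactly when i ∈ S_j, for a family S_0, …, S_{b-1} of subsets of {0, …, a-1}; edges inside a side
-- are oriented arbitrarily.  Then b_j → a_i → b_j' is a path as soon as i ∈ S_j' ∖ S_j, and
-- a_i → b_j → a_i' as soon as i ∈ S_j ∌ i'.  So (U₁, V₁) = (A, B) satisfies (i) if the S_j form an
-- antichain that separates points, and then also (ii) when a, b ≥ 2.  Such a family exists: take b
-- distinct ⌊a/2⌋-subsets (possible as b ≤ C(a, ⌊a/2⌋)), an antichain because they have equal size,
-- and include among them the a cyclic intervals of length ⌊a/2⌋ (possible as a ≤ b), which separate
-- points because ⌊a/2⌋ ≤ a - ⌊a/2⌋.  For K_{1,1} both conditions on the family are vacuous.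

open import Defs renaming (sym to Adj-sym)
open import Data.Nat using (ℕ; zero; suc; _+_; _*_; _∸_; _≤_; _<_; _/_; s≤s; z≤n; _≤?_; _<?_)
open import Data.Nat.Properties
open import Data.Nat.DivMod using (m/n≤m; m/n*n≤m; m≥n⇒m/n>0)
open import Data.Nat.Combinatorics using (_C_; nCk+nC[k+1]≡[n+1]C[k+1])
open import Data.Bool.Properties using () renaming (_≟_ to _≟ᵇ_)
open import Data.Fin as Fin using (Fin; zero; suc; toℕ; inject≤)
import Data.Fin.Properties as Fin
open import Data.Fin.Subset using (Subset; ∣_∣; _∈_; _∉_; _⊈_; ∁; ⁅_⁆; ⊥; inside; outside)
open import Data.Fin.Subset.Properties
  using (_∈?_; _⊆?_; ⊆-antisym; p⊂q⇒∣p∣<∣q∣; x∈p⇒x∉∁p; x∉p⇒x∈∁p; ∣∁p∣≡n∸∣p∣;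
         x∈⁅x⁆; x∈⁅y⁆⇒x≡y; ∣⁅x⁆∣≡1)
open import Data.Vec using ([]; _∷_; here; there)
open import Data.Vec.Properties using (∷-injectiveʳ; ≡-dec)
open import Data.List using (List; []; _∷_; [_]; _++_; map; length; lookup; filter; deduplicate; applyUpTo)
open import Data.List.Properties using (length-++; length-map; length-deduplicate; length-applyUpTo)
open import Data.List.Membership.Propositional using () renaming (_∈_ to _∈ₗ_)
open import Data.List.Membership.Propositional.Properties
  using (∈-lookup; ∈-map⁻; ∈-++⁺ˡ; ∈-++⁺ʳ; ∈-++⁻; ∈-∃++; ∈-filter⁺; ∈-filter⁻;
         ∈-deduplicate⁺; ∈-deduplicate⁻; ∈-applyUpTo⁺; ∈-applyUpTo⁻)
open import Data.List.Relation.Binary.Subset.Propositional using () renaming (_⊆_ to _⊆ₗ_)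
import Data.List.Relation.Unary.All as All
open import Data.List.Relation.Unary.AllPairs using ([]; _∷_)
open import Data.List.Relation.Unary.Any using (here; there; index)
open import Data.List.Relation.Unary.Any.Properties using (lookup-index)
open import Data.List.Relation.Unary.Unique.Propositional using (Unique)
import Data.List.Relation.Unary.Unique.Propositional.Properties as Unique
open import Data.List.Relation.Unary.Unique.DecPropositional.Properties using (deduplicate-!)
open import Data.Product using (Σ; ∃; _×_; _,_; proj₁; proj₂; uncurry)
open import Data.Sum using (_⊎_; inj₁; inj₂; [_,_]′)
import Data.Sum
open import Data.Empty using (⊥-elim)
open import Function using (_∘_)
open import Function.Definitions using (Injective)
open import Relation.Nullary using (yes; no; ¬_; ¬?)
open import Relation.Unary using (Decidable)
open import Relation.Nullary.Decidable using (decidable-stable; _→-dec_)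
open import Relation.Binary.Definitions using (DecidableEquality; tri<; tri≈; tri>)
open import Relation.Binary.PropositionalEquality
  using (_≡_; _≢_; refl; cong; cong₂; sym; trans; subst; subst₂; module ≡-Reasoning)

rank : ∀ {n} (p : Subset n) {x} → x ∈ p → Fin ∣ p ∣
rank (inside  ∷ p) here        = zero
rank (inside  ∷ p) (there x∈p) = suc (rank p x∈p)
rank (outside ∷ p) (there x∈p) = rank p x∈p

rank-irrelevant : ∀ {n} (p : Subset n) {x} (q r : x ∈ p) → rank p q ≡ rank p r
rank-irrelevant (inside  ∷ p) here      here      = refl
rank-irrelevant (inside  ∷ p) (there q) (there r) = cong suc (rank-irrelevant p q r)
rank-irrelevant (outside ∷ p) (there q) (there r) = rank-irrelevant p q r

rank-injective : ∀ {n} (p : Subset n) {x y} (q : x ∈ p) (r : y ∈ p) → rank p q ≡ rank p r → x ≡ y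
rank-injective (inside  ∷ p) here      here      _ = refl
rank-injective (inside  ∷ p) (there q) (there r) e = cong suc (rank-injective p q r (Fin.suc-injective e))
rank-injective (outside ∷ p) (there q) (there r) e = cong suc (rank-injective p q r e)

rank-surjective : ∀ {n} (p : Subset n) (j : Fin ∣ p ∣) → ∃ λ x → Σ (x ∈ p) λ x∈p → rank p x∈p ≡ j
rank-surjective (inside  ∷ p) zero    = zero , here , refl
rank-surjective (inside  ∷ p) (suc j) with rank-surjective p j
... | x , x∈p , refl = suc x , there x∈p , refl
rank-surjective (outside ∷ p) j       with rank-surjective p j
... | x , x∈p , refl = suc x , there x∈p , refl

⊈-witness : ∀ {n} {p q : Subset n} → p ⊈ q → ∃ λ x → x ∈ p × x ∉ q
⊈-witness {n} {p} {q} p⊈q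
  with Fin.¬∀⟶∃¬ n (λ x → x ∈ p → x ∈ q) (λ x → x ∈? p →-dec x ∈? q) (λ p⊆q → p⊈q (p⊆q _))
... | x , x∈p↛x∈q =
  x , decidable-stable (x ∈? p) (λ x∉p → x∈p↛x∈q (⊥-elim ∘ x∉p)) , λ x∈q → x∈p↛x∈q λ _ → x∈q

∣p∣≡∣q∣∧p≢q⇒q⊈p : ∀ {n} {p q : Subset n} → ∣ p ∣ ≡ ∣ q ∣ → p ≢ q → q ⊈ p
∣p∣≡∣q∣∧p≢q⇒q⊈p {p = p} {q} ∣p∣≡∣q∣ p≢q q⊆p with p ⊆? q
... | yes p⊆q = p≢q (⊆-antisym p⊆q q⊆p)
... | no  p⊈q with ⊈-witness p⊈q
...   | x , x∈p , x∉q = <-irrefl (sym ∣p∣≡∣q∣) (p⊂q⇒∣p∣<∣q∣ (q⊆p , x , x∈p , x∉q))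

∃≢ : ∀ {m} → 2 ≤ m → (i : Fin m) → ∃ λ i' → i' ≢ i
∃≢ (s≤s (s≤s _)) zero    = suc zero , λ ()
∃≢ (s≤s (s≤s _)) (suc i) = zero , λ ()

module _ {A : Set} where

  lookup-injective : ∀ {xs : List A} → Unique xs → Injective _≡_ _≡_ (lookup xs)
  lookup-injective {x ∷ xs} (x∉xs ∷ xs!) {zero}  {zero}  _ = refl
  lookup-injective {x ∷ xs} (x∉xs ∷ xs!) {zero}  {suc j} e = ⊥-elim (All.lookup x∉xs (∈-lookup j) e)
  lookup-injective {x ∷ xs} (x∉xs ∷ xs!) {suc i} {zero}  e = ⊥-elim (All.lookup x∉xs (∈-lookup i) (sym e))
  lookup-injective {x ∷ xs} (x∉xs ∷ xs!) {suc i} {suc j} e = cong suc (lookup-injective xs! e)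

  lookup-++ˡ : ∀ (xs ys : List A) {i j} → toℕ j ≡ toℕ i → lookup (xs ++ ys) j ≡ lookup xs i
  lookup-++ˡ (x ∷ xs) ys {zero}  {zero}  _ = refl
  lookup-++ˡ (x ∷ xs) ys {suc i} {suc j} e = lookup-++ˡ xs ys (suc-injective e)

  Unique∧⊆⇒length≤ : ∀ {xs ys : List A} → Unique xs → xs ⊆ₗ ys → length xs ≤ length ys
  Unique∧⊆⇒length≤ {[]}     _            _       = z≤n
  Unique∧⊆⇒length≤ {x ∷ xs} (x∉xs ∷ xs!) x∷xs⊆ys with ∈-∃++ (x∷xs⊆ys (here refl))
  ... | ys₁ , ys₂ , refl =
    subst (suc (length xs) ≤_) (sym length-ys) (s≤s (Unique∧⊆⇒length≤ xs! xs⊆ys₁++ys₂))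
    where
    length-ys : length (ys₁ ++ x ∷ ys₂) ≡ suc (length (ys₁ ++ ys₂))
    length-ys = begin
      length (ys₁ ++ x ∷ ys₂)       ≡⟨ length-++ ys₁ ⟩
      length ys₁ + suc (length ys₂) ≡⟨ +-suc (length ys₁) (length ys₂) ⟩
      suc (length ys₁ + length ys₂) ≡⟨ cong suc (sym (length-++ ys₁)) ⟩
      suc (length (ys₁ ++ ys₂))     ∎
      where open ≡-Reasoning
    xs⊆ys₁++ys₂ : xs ⊆ₗ ys₁ ++ ys₂
    xs⊆ys₁++ys₂ v∈xs with ∈-++⁻ ys₁ (x∷xs⊆ys (there v∈xs))
    ... | inj₁ v∈ys₁         = ∈-++⁺ˡ v∈ys₁
    ... | inj₂ (here refl)   = ⊥-elim (All.lookup x∉xs v∈xs refl)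
    ... | inj₂ (there v∈ys₂) = ∈-++⁺ʳ ys₁ v∈ys₂

module _ {A : Set} (_≟_ : DecidableEquality A) where

  open import Data.List.Membership.DecPropositional _≟_ using () renaming (_∈?_ to _∈ₗ?_)

  injectionCovering : ∀ {b} (xs ys : List A) → Unique ys → length xs ≤ b → b ≤ length ys →
    ∃ λ (f : Fin b → A) → Injective _≡_ _≡_ f ×
      (∀ {v} → v ∈ₗ xs → ∃ λ j → f j ≡ v) × (∀ j → f j ∈ₗ xs ⊎ f j ∈ₗ ys)
  injectionCovering {b} xs ys ys! ∣xs∣≤b b≤∣ys∣ = f , f-injective , f-covers , f-source
    where
    xs′ : List A
    xs′ = deduplicate _≟_ xs

    fresh? : Decidable (λ y → ¬ y ∈ₗ xs′)
    fresh? y = ¬? (y ∈ₗ? xs′)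

    zs : List A
    zs = xs′ ++ filter fresh? ys

    ys⊆zs : ys ⊆ₗ zs
    ys⊆zs {y} y∈ys with y ∈ₗ? xs′
    ... | yes y∈xs′ = ∈-++⁺ˡ y∈xs′
    ... | no  y∉xs′ = ∈-++⁺ʳ xs′ (∈-filter⁺ fresh? y∈ys y∉xs′)

    b≤∣zs∣ : b ≤ length zs
    b≤∣zs∣ = ≤-trans b≤∣ys∣ (Unique∧⊆⇒length≤ ys! ys⊆zs)

    f : Fin b → A
    f j = lookup zs (inject≤ j b≤∣zs∣)

    f-injective : Injective _≡_ _≡_ f
    f-injective {j} {j'} fj≡fj' = Fin.toℕ-injective (begin
      toℕ j                   ≡⟨ sym (Fin.toℕ-inject≤ j b≤∣zs∣) ⟩
      toℕ (inject≤ j b≤∣zs∣)  ≡⟨ cong toℕ (lookup-injective zs! fj≡fj') ⟩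
      toℕ (inject≤ j' b≤∣zs∣) ≡⟨ Fin.toℕ-inject≤ j' b≤∣zs∣ ⟩
      toℕ j'                  ∎)
      where
      open ≡-Reasoning
      zs! : Unique zs
      zs! = Unique.++⁺ (deduplicate-! _≟_ xs) (Unique.filter⁺ fresh? ys!)
        λ (v∈xs′ , v∈rest) → proj₂ (∈-filter⁻ fresh? {xs = ys} v∈rest) v∈xs′

    f-covers : ∀ {v} → v ∈ₗ xs → ∃ λ j → f j ≡ v
    f-covers {v} v∈xs = j , (begin
      lookup zs (inject≤ j b≤∣zs∣)
        ≡⟨ lookup-++ˡ xs′ _ (trans (Fin.toℕ-inject≤ j b≤∣zs∣) (Fin.toℕ-inject≤ _ _)) ⟩
      lookup xs′ (index v∈xs′)
        ≡⟨ sym (lookup-index v∈xs′) ⟩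
      v ∎)
      where
      open ≡-Reasoning
      v∈xs′ : v ∈ₗ xs′
      v∈xs′ = ∈-deduplicate⁺ _≟_ v∈xs
      j : Fin b
      j = inject≤ (index v∈xs′) (≤-trans (length-deduplicate _≟_ xs) ∣xs∣≤b)

    f-source : ∀ j → f j ∈ₗ xs ⊎ f j ∈ₗ ys
    f-source j with ∈-++⁻ xs′ (∈-lookup {xs = zs} (inject≤ j b≤∣zs∣))
    ... | inj₁ fj∈xs′  = inj₁ (∈-deduplicate⁻ _≟_ xs fj∈xs′)
    ... | inj₂ fj∈rest = inj₂ (proj₁ (∈-filter⁻ fresh? {xs = ys} fj∈rest))

record SeparatingAntichain (a b : ℕ) : Set where
  field
    family     : Fin b → Subset a
    antichain  : ∀ {j j'} → j ≢ j' → family j ⊈ family j'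
    separating : ∀ {i i'} → i ≢ i' → ∃ λ j → i ∈ family j × i' ∉ family j

subsetsOfSize : ∀ m → ℕ → List (Subset m)
subsetsOfSize zero zero = [ [] ]
subsetsOfSize zero (suc k) = []
subsetsOfSize (suc m) zero = map (outside ∷_) (subsetsOfSize m zero)
subsetsOfSize (suc m) (suc k) =
  map (inside ∷_) (subsetsOfSize m k) ++ map (outside ∷_) (subsetsOfSize m (suc k))

length-subsetsOfSize : ∀ m k → length (subsetsOfSize m k) ≡ m C k
length-subsetsOfSize zero zero = refl
length-subsetsOfSize zero (suc k) = refl
length-subsetsOfSize (suc m) zero = begin
  length (map (outside ∷_) (subsetsOfSize m zero)) ≡⟨ length-map _ (subsetsOfSize m zero) ⟩
  length (subsetsOfSize m zero)                     ≡⟨ length-subsetsOfSize m zero ⟩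
  suc m C zero ∎
  where open ≡-Reasoning
length-subsetsOfSize (suc m) (suc k) = begin
  length (map (inside ∷_) (subsetsOfSize m k) ++ map (outside ∷_) (subsetsOfSize m (suc k)))
    ≡⟨ length-++ (map (inside ∷_) (subsetsOfSize m k)) ⟩
  length (map (inside ∷_) (subsetsOfSize m k)) + length (map (outside ∷_) (subsetsOfSize m (suc k)))
    ≡⟨ cong₂ _+_ (length-map _ (subsetsOfSize m k)) (length-map _ (subsetsOfSize m (suc k))) ⟩
  length (subsetsOfSize m k) + length (subsetsOfSize m (suc k))
    ≡⟨ cong₂ _+_ (length-subsetsOfSize m k) (length-subsetsOfSize m (suc k)) ⟩
  m C k + m C suc k
    ≡⟨ nCk+nC[k+1]≡[n+1]C[k+1] m k ⟩
  suc m C suc k ∎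
  where open ≡-Reasoning

∈-subsetsOfSize⇒∣∣ : ∀ m k {p} → p ∈ₗ subsetsOfSize m k → ∣ p ∣ ≡ k
∈-subsetsOfSize⇒∣∣ zero zero (here refl) = refl
∈-subsetsOfSize⇒∣∣ (suc m) zero p∈ with ∈-map⁻ _ p∈
... | _ , q∈ , refl = ∈-subsetsOfSize⇒∣∣ m zero q∈
∈-subsetsOfSize⇒∣∣ (suc m) (suc k) p∈ with ∈-++⁻ (map (inside ∷_) (subsetsOfSize m k)) p∈
... | inj₁ p∈ᵢ with ∈-map⁻ _ p∈ᵢ
...   | _ , q∈ , refl = cong suc (∈-subsetsOfSize⇒∣∣ m k q∈)
∈-subsetsOfSize⇒∣∣ (suc m) (suc k) p∈ | inj₂ p∈ₒ with ∈-map⁻ _ p∈ₒ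
...   | _ , q∈ , refl = ∈-subsetsOfSize⇒∣∣ m (suc k) q∈

subsetsOfSize-unique : ∀ m k → Unique (subsetsOfSize m k)
subsetsOfSize-unique zero zero = All.[] ∷ []
subsetsOfSize-unique zero (suc k) = []
subsetsOfSize-unique (suc m) zero = Unique.map⁺ ∷-injectiveʳ (subsetsOfSize-unique m zero)
subsetsOfSize-unique (suc m) (suc k) = Unique.++⁺
  (Unique.map⁺ ∷-injectiveʳ (subsetsOfSize-unique m k))
  (Unique.map⁺ ∷-injectiveʳ (subsetsOfSize-unique m (suc k)))
  (uncurry inside≢outside)
  where
  inside≢outside : ∀ {p} → p ∈ₗ map (inside ∷_) (subsetsOfSize m k) →
                   ¬ p ∈ₗ map (outside ∷_) (subsetsOfSize m (suc k))
  inside≢outside p∈ᵢ p∈ₒ with ∈-map⁻ _ p∈ᵢ | ∈-map⁻ _ p∈ₒ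
  ... | _ , _ , refl | _ , _ , ()

interval : ∀ {m} → ℕ → ℕ → Subset m
interval {zero}  _       _       = []
interval {suc m} (suc s) l       = outside ∷ interval s l
interval {suc m} zero    zero    = outside ∷ interval zero zero
interval {suc m} zero    (suc l) = inside ∷ interval zero l

∈-interval⁺ : ∀ {m s l} (i : Fin m) → s ≤ toℕ i → toℕ i < s + l → i ∈ interval s l
∈-interval⁺ {suc m} {zero}  {suc l} zero    _        _        = here
∈-interval⁺ {suc m} {zero}  {suc l} (suc i) _        (s≤s lt) = there (∈-interval⁺ i z≤n lt)
∈-interval⁺ {suc m} {suc s}         (suc i) (s≤s le) (s≤s lt) = there (∈-interval⁺ i le lt)

∈-interval⁻ : ∀ {m s l} (i : Fin m) → i ∈ interval s l → s ≤ toℕ i × toℕ i < s + l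
∈-interval⁻ {suc m} {zero}  {suc l} zero    here      = z≤n , s≤s z≤n
∈-interval⁻ {suc m} {zero}  {suc l} (suc i) (there p) with ∈-interval⁻ i p
... | _ , lt = z≤n , s≤s lt
∈-interval⁻ {suc m} {zero}  {zero}  (suc i) (there p) with ∈-interval⁻ i p
... | _ , ()
∈-interval⁻ {suc m} {suc s}         (suc i) (there p) with ∈-interval⁻ i p
... | le , lt = s≤s le , s≤s lt

∉-interval : ∀ {m s l} (i : Fin m) → toℕ i < s ⊎ s + l ≤ toℕ i → i ∉ interval s l
∉-interval i (inj₁ i<s)   i∈ = <⇒≱ i<s (proj₁ (∈-interval⁻ i i∈))
∉-interval i (inj₂ s+l≤i) i∈ = <⇒≱ (proj₂ (∈-interval⁻ i i∈)) s+l≤i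

∣interval∣ : ∀ {m s l} → s + l ≤ m → ∣ interval {m} s l ∣ ≡ l
∣interval∣ {zero}  {zero}  {zero}  _        = refl
∣interval∣ {suc m} {suc s}         (s≤s le) = ∣interval∣ le
∣interval∣ {suc m} {zero}  {zero}  _        = ∣interval∣ {m} {0} {0} z≤n
∣interval∣ {suc m} {zero}  {suc l} (s≤s le) = cong suc (∣interval∣ le)

-- The cyclic intervals of length k in ℤ/(k + d): the straight ones [s, s + k) for s ≤ d, and the
-- wrapped ones, complements of [u, u + d) for 1 ≤ u < k (listed by t = u - 1).
module CyclicIntervals {k d : ℕ} (1≤k : 1 ≤ k) (k≤d : k ≤ d) where

  straight : ℕ → Subset (k + d)
  straight s = interval s k

  wrapped : ℕ → Subset (k + d)
  wrapped t = ∁ (interval (suc t) d)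

  cyclicIntervals : List (Subset (k + d))
  cyclicIntervals = applyUpTo straight (suc d) ++ applyUpTo wrapped (k ∸ 1)

  length-cyclicIntervals : length cyclicIntervals ≡ k + d
  length-cyclicIntervals = begin
    length cyclicIntervals
      ≡⟨ length-++ (applyUpTo straight (suc d)) ⟩
    length (applyUpTo straight (suc d)) + length (applyUpTo wrapped (k ∸ 1))
      ≡⟨ cong₂ _+_ (length-applyUpTo straight (suc d)) (length-applyUpTo wrapped (k ∸ 1)) ⟩
    suc d + (k ∸ 1)
      ≡⟨ +-comm (suc d) (k ∸ 1) ⟩
    (k ∸ 1) + suc d
      ≡⟨ +-suc (k ∸ 1) d ⟩
    suc (k ∸ 1) + d
      ≡⟨ cong (_+ d) (m+[n∸m]≡n 1≤k) ⟩
    k + d ∎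
    where open ≡-Reasoning

  ∈-cyclicIntervals⇒∣∣ : ∀ {S} → S ∈ₗ cyclicIntervals → ∣ S ∣ ≡ k
  ∈-cyclicIntervals⇒∣∣ S∈ with ∈-++⁻ (applyUpTo straight (suc d)) S∈
  ... | inj₁ S∈ₛ with ∈-applyUpTo⁻ straight S∈ₛ
  ...   | s , s<1+d , refl = ∣interval∣ (subst (_≤ k + d) (+-comm k s) (+-monoʳ-≤ k (≤-pred s<1+d)))
  ∈-cyclicIntervals⇒∣∣ S∈ | inj₂ S∈ᵥ with ∈-applyUpTo⁻ wrapped S∈ᵥ
  ...   | t , t<k-1 , refl = begin
    ∣ wrapped t ∣                          ≡⟨ ∣∁p∣≡n∸∣p∣ (interval {k + d} (suc t) d) ⟩
    k + d ∸ ∣ interval {k + d} (suc t) d ∣ ≡⟨ cong (k + d ∸_) (∣interval∣ 1+t+d≤k+d) ⟩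
    k + d ∸ d                              ≡⟨ m+n∸n≡m k d ⟩
    k                                      ∎
    where
    open ≡-Reasoning
    1+t+d≤k+d : suc t + d ≤ k + d
    1+t+d≤k+d = +-monoˡ-≤ d (≤-trans t<k-1 (m∸n≤m k 1))

  Separated : Fin (k + d) → Fin (k + d) → Set
  Separated i i' = ∃ λ S → S ∈ₗ cyclicIntervals × i ∈ S × i' ∉ S

  separatedByStraight : ∀ {i i'} s → s ≤ d → s ≤ toℕ i → toℕ i < s + k →
                        toℕ i' < s ⊎ s + k ≤ toℕ i' → Separated i i'
  separatedByStraight {i} {i'} s s≤d s≤i i<s+k i'∉ =
    straight s , ∈-++⁺ˡ (∈-applyUpTo⁺ straight (s≤s s≤d)) ,
    ∈-interval⁺ i s≤i i<s+k , ∉-interval i' i'∉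

  separatedByWrapped : ∀ {i i'} u → 1 ≤ u → u < k → toℕ i < u ⊎ u + d ≤ toℕ i →
                       u ≤ toℕ i' → toℕ i' < u + d → Separated i i'
  separatedByWrapped {i} {i'} (suc t) _ u<k i∉ u≤i' i'<u+d =
    wrapped t ,
    ∈-++⁺ʳ (applyUpTo straight (suc d)) (∈-applyUpTo⁺ wrapped (∸-monoˡ-< u<k (s≤s z≤n))) ,
    x∉p⇒x∈∁p (∉-interval i i∉) , x∈p⇒x∉∁p (∈-interval⁺ i' u≤i' i'<u+d)

  separatedByIntervalStartingAt : ∀ {i i'} → toℕ i ≤ d →
                                  toℕ i' < toℕ i ⊎ toℕ i + k ≤ toℕ i' → Separated i i'
  separatedByIntervalStartingAt {i} i≤d =
    separatedByStraight (toℕ i) i≤d ≤-refl (m<m+n (toℕ i) 1≤k)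

  separatedByIntervalEndingAt : ∀ {i i'} → k ≤ suc (toℕ i) →
                                toℕ i' < suc (toℕ i) ∸ k ⊎ toℕ i < toℕ i' → Separated i i'
  separatedByIntervalEndingAt {i} {i'} k≤1+i i'∉ =
    separatedByStraight s s≤d (∸-monoʳ-≤ (suc (toℕ i)) 1≤k) (≤-reflexive (sym s+k≡1+i))
      (Data.Sum.map₂ (subst (_≤ toℕ i') (sym s+k≡1+i)) i'∉)
    where
    s : ℕ
    s = suc (toℕ i) ∸ k
    s+k≡1+i : s + k ≡ suc (toℕ i)
    s+k≡1+i = m∸n+n≡m k≤1+i
    s≤d : s ≤ d
    s≤d = subst (s ≤_) (m+n∸m≡n k d) (∸-monoˡ-≤ k (Fin.toℕ<n i))

  separatedByWrappedEndingAt : ∀ {i i'} → suc (toℕ i) < k →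
                               toℕ i < toℕ i' → toℕ i' < suc (toℕ i) + d → Separated i i'
  separatedByWrappedEndingAt {i} 2+i≤k =
    separatedByWrapped (suc (toℕ i)) (s≤s z≤n) 2+i≤k (inj₁ ≤-refl)

  separatedByWrappedStartingAt : ∀ {i i'} → d < toℕ i →
                                 toℕ i ∸ d ≤ toℕ i' → toℕ i' < toℕ i → Separated i i'
  separatedByWrappedStartingAt {i} {i'} d<i u≤i' i'<i =
    separatedByWrapped u (m<n⇒0<n∸m d<i) u<k (inj₂ (≤-reflexive u+d≡i)) u≤i'
      (subst (toℕ i' <_) (sym u+d≡i) i'<i)
    where
    u : ℕ
    u = toℕ i ∸ d
    u+d≡i : u + d ≡ toℕ i
    u+d≡i = m∸n+n≡m (<⇒≤ d<i)
    u<k : u < k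
    u<k = subst (u <_) (m+n∸n≡m k d) (∸-monoˡ-< (Fin.toℕ<n i) (<⇒≤ d<i))

  separatedBefore : ∀ {i i'} → toℕ i < toℕ i' → Separated i i'
  separatedBefore {i} {i'} i<i' with k ≤? suc (toℕ i)
  ... | yes k≤1+i = separatedByIntervalEndingAt k≤1+i (inj₂ i<i')
  ... | no  k≰1+i with toℕ i' <? suc (toℕ i) + d
  ...   | yes i'<1+i+d = separatedByWrappedEndingAt (≰⇒> k≰1+i) i<i' i'<1+i+d
  ...   | no  i'≮1+i+d = separatedByIntervalStartingAt i≤d (inj₂ i+k≤i')
    where
    i≤d : toℕ i ≤ d
    i≤d = ≤-trans (<⇒≤ (<-trans (n<1+n (toℕ i)) (≰⇒> k≰1+i))) k≤d
    i+k≤i' : toℕ i + k ≤ toℕ i'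
    i+k≤i' = ≤-trans (+-monoʳ-≤ (toℕ i) k≤d) (≤-trans (n≤1+n _) (≮⇒≥ i'≮1+i+d))

  separatedAfter : ∀ {i i'} → toℕ i' < toℕ i → Separated i i'
  separatedAfter {i} {i'} i'<i with toℕ i ≤? d
  ... | yes i≤d = separatedByIntervalStartingAt i≤d (inj₁ i'<i)
  ... | no  i≰d with toℕ i' <? suc (toℕ i) ∸ k
  ...   | yes i'<1+i-k = separatedByIntervalEndingAt k≤1+i (inj₁ i'<1+i-k)
    where
    k≤1+i : k ≤ suc (toℕ i)
    k≤1+i = ≤-trans k≤d (<⇒≤ (<-trans (≰⇒> i≰d) (n<1+n (toℕ i))))
  ...   | no  i'≮1+i-k = separatedByWrappedStartingAt (≰⇒> i≰d) i-d≤i' i'<i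
    where
    i-d≤i' : toℕ i ∸ d ≤ toℕ i'
    i-d≤i' = ≤-trans (∸-monoʳ-≤ (suc (toℕ i)) (≤-trans k≤d (n≤1+n d))) (≮⇒≥ i'≮1+i-k)

  cyclicIntervals-separate : ∀ {i i'} → i ≢ i' → Separated i i'
  cyclicIntervals-separate {i} {i'} i≢i' with <-cmp (toℕ i) (toℕ i')
  ... | tri< i<i' _ _ = separatedBefore i<i'
  ... | tri≈ _ i≡i' _ = ⊥-elim (i≢i' (Fin.toℕ-injective i≡i'))
  ... | tri> _ _ i'<i = separatedAfter i'<i

  separatingAntichainOfSize : ∀ {b} → k + d ≤ b → b ≤ (k + d) C k → SeparatingAntichain (k + d) b
  separatingAntichainOfSize {b} a≤b b≤C
    with injectionCovering (≡-dec _≟ᵇ_) cyclicIntervals (subsetsOfSize (k + d) k)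
           (subsetsOfSize-unique (k + d) k)
           (subst (_≤ b) (sym length-cyclicIntervals) a≤b)
           (subst (b ≤_) (sym (length-subsetsOfSize (k + d) k)) b≤C)
  ... | S , S-injective , S-covers , S-source = record
    { family     = S
    ; antichain  = λ j≢j' → ∣p∣≡∣q∣∧p≢q⇒q⊈p (trans (∣S∣ _) (sym (∣S∣ _))) (j≢j' ∘ S-injective ∘ sym)
    ; separating = separating
    }
    where
    ∣S∣ : ∀ j → ∣ S j ∣ ≡ k
    ∣S∣ j = [ ∈-cyclicIntervals⇒∣∣ , ∈-subsetsOfSize⇒∣∣ (k + d) k ]′ (S-source j)

    separating : ∀ {i i'} → i ≢ i' → ∃ λ j → i ∈ S j × i' ∉ S j
    separating i≢i' with cyclicIntervals-separate i≢i'
    ... | T , T∈ , i∈T , i'∉T with S-covers T∈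
    ...   | j , refl = j , i∈T , i'∉T

separatingAntichain : ∀ {a b} → 2 ≤ a → a ≤ b → b ≤ a C (a / 2) → SeparatingAntichain a b
separatingAntichain {a} {b} 2≤a a≤b b≤C =
  subst (λ m → SeparatingAntichain m b) k+d≡a
    (CyclicIntervals.separatingAntichainOfSize 1≤k k≤d (subst (_≤ b) (sym k+d≡a) a≤b)
      (subst (λ m → b ≤ m C k) (sym k+d≡a) b≤C))
  where
  k d : ℕ
  k = a / 2
  d = a ∸ k
  k+d≡a : k + d ≡ a
  k+d≡a = m+[n∸m]≡n (m/n≤m a 2)
  1≤k : 1 ≤ k
  1≤k = m≥n⇒m/n>0 2≤a
  k≤d : k ≤ d
  k≤d = m+n≤o⇒m≤o∸n k (subst (_≤ a) k*2≡k+k (m/n*n≤m a 2))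
    where
    k*2≡k+k : k * 2 ≡ k + k
    k*2≡k+k = trans (*-comm k 2) (cong (k +_) (+-identityʳ k))

trivialAntichain : SeparatingAntichain 1 1
trivialAntichain = record
  { family     = λ _ → ⊥
  ; antichain  = λ { {zero} {zero} 0≢0 → ⊥-elim (0≢0 refl) }
  ; separating = λ { {zero} {zero} 0≢0 → ⊥-elim (0≢0 refl) }
  }

module AntichainOrientation {n} (R : SimpleGraph n) {W A B : Subset n}
  (partition : IsPartition W A B) (A×B⊆R : ∀ x y → x ∈ A → y ∈ B → Adj R x y)
  (F : SeparatingAntichain ∣ A ∣ ∣ B ∣) where

  open SeparatingAntichain F

  private
    W⊆A∪B : ∀ x → x ∈ W → x ∈ A ⊎ x ∈ B
    W⊆A∪B = proj₁ partition
    A⊆W : ∀ x → x ∈ A → x ∈ W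
    A⊆W = proj₁ (proj₂ partition)
    B⊆W : ∀ x → x ∈ B → x ∈ W
    B⊆W = proj₁ (proj₂ (proj₂ partition))
    A∩B=∅ : ∀ x → x ∈ A → x ∉ B
    A∩B=∅ = proj₂ (proj₂ (proj₂ partition))

  SameSide : Fin n → Fin n → Set
  SameSide x y = (x ∈ A × y ∈ A) ⊎ (x ∈ B × y ∈ B)

  data Directed : Fin n → Fin n → Set where
    A→B    : ∀ {x y} (x∈A : x ∈ A) (y∈B : y ∈ B) → rank A x∈A ∈ family (rank B y∈B) → Directed x y
    B→A    : ∀ {x y} (x∈B : x ∈ B) (y∈A : y ∈ A) → rank A y∈A ∉ family (rank B x∈B) → Directed x y
    within : ∀ {x y} → SameSide x y → Adj R x y → x Fin.< y → Directed x y

  ¬SameSide-across : ∀ {x y} → x ∈ A → y ∈ B → ¬ SameSide x y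
  ¬SameSide-across x∈A y∈B (inj₁ (_ , y∈A)) = A∩B=∅ _ y∈A y∈B
  ¬SameSide-across x∈A y∈B (inj₂ (x∈B , _)) = A∩B=∅ _ x∈A x∈B

  SameSide-sym : ∀ {x y} → SameSide x y → SameSide y x
  SameSide-sym = Data.Sum.map Data.Product.swap Data.Product.swap

  ∈family-irrelevant : ∀ {x y} (x∈A x∈A′ : x ∈ A) (y∈B y∈B′ : y ∈ B) →
                       rank A x∈A ∈ family (rank B y∈B) → rank A x∈A′ ∈ family (rank B y∈B′)
  ∈family-irrelevant x∈A x∈A′ y∈B y∈B′ =
    subst₂ (λ i j → i ∈ family j) (rank-irrelevant A x∈A x∈A′) (rank-irrelevant B y∈B y∈B′)

  directed-edge : ∀ {x y} → Directed x y → x ∈ W × y ∈ W × Adj R x y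
  directed-edge (A→B x∈A y∈B _) = A⊆W _ x∈A , B⊆W _ y∈B , A×B⊆R _ _ x∈A y∈B
  directed-edge (B→A x∈B y∈A _) = B⊆W _ x∈B , A⊆W _ y∈A , Adj-sym R (A×B⊆R _ _ y∈A x∈B)
  directed-edge (within (inj₁ (x∈A , y∈A)) xy∈R _) = A⊆W _ x∈A , A⊆W _ y∈A , xy∈R
  directed-edge (within (inj₂ (x∈B , y∈B)) xy∈R _) = B⊆W _ x∈B , B⊆W _ y∈B , xy∈R

  directed-antisym : ∀ {x y} → Directed x y → ¬ Directed y x
  directed-antisym (A→B x∈A y∈B i∈Sⱼ) (B→A y∈B′ x∈A′ i∉Sⱼ) = i∉Sⱼ (∈family-irrelevant x∈A x∈A′ y∈B y∈B′ i∈Sⱼ)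
  directed-antisym (B→A x∈B y∈A i∉Sⱼ) (A→B y∈A′ x∈B′ i∈Sⱼ) = i∉Sⱼ (∈family-irrelevant y∈A′ y∈A x∈B′ x∈B i∈Sⱼ)
  directed-antisym (A→B _ y∈B _) (A→B y∈A _ _)       = A∩B=∅ _ y∈A y∈B
  directed-antisym (B→A _ y∈A _) (B→A y∈B _ _)       = A∩B=∅ _ y∈A y∈B
  directed-antisym (A→B x∈A y∈B _) (within s _ _)    = ¬SameSide-across x∈A y∈B (SameSide-sym s)
  directed-antisym (B→A x∈B y∈A _) (within s _ _)    = ¬SameSide-across y∈A x∈B s
  directed-antisym (within s _ _) (A→B y∈A x∈B _)    = ¬SameSide-across y∈A x∈B (SameSide-sym s)
  directed-antisym (within s _ _) (B→A y∈B x∈A _)    = ¬SameSide-across x∈A y∈B s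
  directed-antisym (within _ _ x<y) (within _ _ y<x) = Fin.<-asym x<y y<x

  orientAcross : ∀ {x y} → x ∈ A → y ∈ B → Directed x y ⊎ Directed y x
  orientAcross x∈A y∈B with rank A x∈A ∈? family (rank B y∈B)
  ... | yes i∈Sⱼ = inj₁ (A→B x∈A y∈B i∈Sⱼ)
  ... | no  i∉Sⱼ = inj₂ (B→A y∈B x∈A i∉Sⱼ)

  orientWithin : ∀ {x y} → SameSide x y → Adj R x y → Directed x y ⊎ Directed y x
  orientWithin {x} {y} s xy∈R with Fin.<-cmp x y
  ... | tri< x<y _ _ = inj₁ (within s xy∈R x<y)
  ... | tri≈ _ refl _ = ⊥-elim (irrefl R xy∈R)
  ... | tri> _ _ y<x = inj₂ (within (SameSide-sym s) (Adj-sym R xy∈R) y<x)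

  orient : ∀ {x y} → x ∈ W → y ∈ W → Adj R x y → Directed x y ⊎ Directed y x
  orient {x} {y} x∈W y∈W xy∈R with W⊆A∪B x x∈W | W⊆A∪B y y∈W
  ... | inj₁ x∈A | inj₁ y∈A = orientWithin (inj₁ (x∈A , y∈A)) xy∈R
  ... | inj₂ x∈B | inj₂ y∈B = orientWithin (inj₂ (x∈B , y∈B)) xy∈R
  ... | inj₁ x∈A | inj₂ y∈B = orientAcross x∈A y∈B
  ... | inj₂ x∈B | inj₁ y∈A = Data.Sum.swap (orientAcross y∈A x∈B)

  orientation : Orientation R W
  orientation = record
    { Arc = Directed ; arc-edge = directed-edge ; edge-arc = orient ; antisym = directed-antisym }

  cond-i : Cond-i orientation A B
  cond-i = A-close , B-close
    where
    A-close : ∀ x y → x ∈ A → y ∈ A → Dist≤2 orientation x y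
    A-close x y x∈A y∈A with x Fin.≟ y
    ... | yes x≡y = inj₁ x≡y
    ... | no  x≢y with separating (x≢y ∘ rank-injective A x∈A y∈A)
    ...   | j , x∈Sⱼ , y∉Sⱼ with rank-surjective B j
    ...     | v , v∈B , refl = inj₂ (inj₂ (v , A→B x∈A v∈B x∈Sⱼ , B→A v∈B y∈A y∉Sⱼ))

    B-close : ∀ x y → x ∈ B → y ∈ B → Dist≤2 orientation x y
    B-close x y x∈B y∈B with x Fin.≟ y
    ... | yes x≡y = inj₁ x≡y
    ... | no  x≢y with ⊈-witness (antichain (x≢y ∘ rank-injective B x∈B y∈B ∘ sym))
    ...   | i , i∈Sy , i∉Sx with rank-surjective A i
    ...     | u , u∈A , refl = inj₂ (inj₂ (u , B→A x∈B u∈A i∉Sx , A→B u∈A y∈B i∈Sy))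

  cond-ii : 2 ≤ ∣ A ∣ → 2 ≤ ∣ B ∣ → Cond-ii orientation A B
  cond-ii 2≤∣A∣ 2≤∣B∣ = A-neighbours , B-neighbours
    where
    A-neighbours : ∀ x → x ∈ A →
      (∃ λ y → y ∈ B × Directed y x) × (∃ λ y → y ∈ B × Directed x y)
    A-neighbours x x∈A with ∃≢ 2≤∣A∣ (rank A x∈A)
    ... | i , i≢x with separating i≢x | separating (i≢x ∘ sym)
    ...   | j , _ , x∉Sⱼ | j' , x∈Sⱼ′ , _ with rank-surjective B j | rank-surjective B j'
    ...     | v , v∈B , refl | v' , v'∈B , refl =
      (v , v∈B , B→A v∈B x∈A x∉Sⱼ) , (v' , v'∈B , A→B x∈A v'∈B x∈Sⱼ′)

    B-neighbours : ∀ x → x ∈ B →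
      (∃ λ y → y ∈ A × Directed y x) × (∃ λ y → y ∈ A × Directed x y)
    B-neighbours x x∈B with ∃≢ 2≤∣B∣ (rank B x∈B)
    ... | j , j≢x with ⊈-witness (antichain (j≢x ∘ sym)) | ⊈-witness (antichain j≢x)
    ...   | i , i∈Sₓ , _ | i' , _ , i'∉Sₓ with rank-surjective A i | rank-surjective A i'
    ...     | u , u∈A , refl | u' , u'∈A , refl =
      (u , u∈A , A→B u∈A x∈B i∈Sₓ) , (u' , u'∈A , B→A x∈B u'∈A i'∉Sₓ)

singletons-partition : ∀ {n} {W : Subset n} {x y} → x ≢ y → x ∈ W → y ∈ W →
                       (∀ z → z ∈ W → z ≡ x ⊎ z ≡ y) → IsPartition W ⁅ x ⁆ ⁅ y ⁆
singletons-partition {W = W} {x} {y} x≢y x∈W y∈W W⊆xy =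
  (λ z z∈W → Data.Sum.map (λ { refl → x∈⁅x⁆ x }) (λ { refl → x∈⁅x⁆ y }) (W⊆xy z z∈W)) ,
  (λ z z∈⁅x⁆ → subst (_∈ W) (sym (x∈⁅y⁆⇒x≡y x z∈⁅x⁆)) x∈W) ,
  (λ z z∈⁅y⁆ → subst (_∈ W) (sym (x∈⁅y⁆⇒x≡y y z∈⁅y⁆)) y∈W) ,
  (λ z z∈⁅x⁆ z∈⁅y⁆ → x≢y (trans (sym (x∈⁅y⁆⇒x≡y x z∈⁅x⁆)) (x∈⁅y⁆⇒x≡y y z∈⁅y⁆)))

lemma1 : ∀ {n} (R : SimpleGraph n) (W : Subset n) →
    ((a b : ℕ) → 2 ≤ a → a ≤ b → b ≤ a C (a / 2) → HasSpanningKab R W a b →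
      Σ (Orientation R W) IsNontrivialGood) ×
    (IsK11 R W → Σ (Orientation R W) IsGood)
lemma1 R W = nontrivial , k11
  where
  nontrivial : (a b : ℕ) → 2 ≤ a → a ≤ b → b ≤ a C (a / 2) → HasSpanningKab R W a b →
               Σ (Orientation R W) IsNontrivialGood
  nontrivial a b 2≤a a≤b b≤C (A , B , partition , refl , refl , A×B⊆R) =
    orientation , A , B , partition , cond-i , cond-ii 2≤a (≤-trans 2≤a a≤b)
    where open AntichainOrientation R partition A×B⊆R (separatingAntichain 2≤a a≤b b≤C)

  k11 : IsK11 R W → Σ (Orientation R W) IsGood
  k11 (x , y , x≢y , x∈W , y∈W , W⊆xy , xy∈R) = orientation , ⁅ x ⁆ , ⁅ y ⁆ , partition , cond-i
    where
    partition : IsPartition W ⁅ x ⁆ ⁅ y ⁆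
    partition = singletons-partition x≢y x∈W y∈W W⊆xy
    ⁅x⁆×⁅y⁆⊆R : ∀ u v → u ∈ ⁅ x ⁆ → v ∈ ⁅ y ⁆ → Adj R u v
    ⁅x⁆×⁅y⁆⊆R u v u∈⁅x⁆ v∈⁅y⁆ =
      subst₂ (Adj R) (sym (x∈⁅y⁆⇒x≡y x u∈⁅x⁆)) (sym (x∈⁅y⁆⇒x≡y y v∈⁅y⁆)) xy∈R
    open AntichainOrientation R partition ⁅x⁆×⁅y⁆⊆R
      (subst₂ SeparatingAntichain (sym (∣⁅x⁆∣≡1 x)) (sym (∣⁅x⁆∣≡1 y)) trivialAntichain)
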